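{- Let $n\ge 3$ and let $\mathcal{P}$ be a chiral $n$-polytope with base flag $\Phi$, and for $1\le i\le n-1$ let $\tau_i$ be the automorphism with $\Phi\tau_i=r_ir_0\Phi$; put $\tau_0=1$, so $\Gamma(\mathcal{P})=\langle\tau_1,\dots,\tau_{n-1}\rangle$. Let $(\mathcal{X},\Gamma(\mathcal{P}),\xi)$ be the voltage graph $\mathcal{A}_n$ described below, and suppose $\mathcal{X}^\xi$ is a maniplex. Then $\mathcal{X}^\xi$ has symmetry type graph isomorphic to $\mathcal{X}$ if and only if $\mathcal{P}$ is not self-dual.
   Context: Graphs may have semi-edges and parallel edges (darts with initial-vertex map $I$ and involution $d\mapsto d^{ -1}$, $T(d)=I(d^{ -1})$). An $n$-premaniplex is a connected graph with edges colored by $\{0,\dots,n-1\}$, each vertex (flag) incident to exactly one edge of each color, and alternating paths of length 4 in colors $i,j$ closed for $|i-j|>1$; an $n$-maniplex is a simple $n$-premaniplex. $r_i\Phi$ is the flag joined to $\Phi$ by its color-$i$ edge. Automorphisms are color-preserving graph automorphisms, acting on the right. An abstract $n$-polytope is an $n$-maniplex such that whenever two flags are joined by a path with colors in $[0,m]$ and by one with colors in $[k,n-1]$, they are joined by a path with colors in $[k,m]$. A maniplex is chiral if its automorphism group has exactly two flag orbits and adjacent flags lie in different orbits. The dual of an $n$-maniplex recolors color $i$ as $n-1-i$; it is self-dual if isomorphic to its dual. The voltage graph $\mathcal{A}_n$: $\mathcal{X}$ consists of two $n$-gons (each a cycle of $2n$ flags alternating colors 0 and 1), an outer one with a chosen flag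 $a$ and an inner one with a chosen flag $b$; for $0\le i\le n-1$ the $i$-th 1-face of the outer one is $\{(r_1r_0)^ia,\ r_0(r_1r_0)^ia\}$ (left flag, right flag) and similarly for the inner one with $b$. Edges of color 2 join $(r_1r_0)^ia$ with $r_0(r_1r_0)^ib$ and $r_0(r_1r_0)^ia$ with $(r_1r_0)^ib$, for each $i$. Voltages: darts of colors 0,1 have trivial voltage; each dart of color 2 starting at a flag of the $i$-th 1-face of the outer $n$-gon has voltage $\tau_i$ (trivial for $i=0$), and consequently each dart of color 2 starting at the $i$-th 1-face of the inner $n$-gon has voltage $\tau_i^{ -1}$. A voltage assignment satisfies $\xi(d^{ -1})=\xi(d)^{ -1}$; the derived graph $\mathcal{X}^\xi$ has vertex set $V(\mathcal{X})\times\Gamma$ and darts $(d,\gamma)$ from $(I(d),\gamma)$ to $(T(d),\xi(d)\gamma)$, colors inherited. The symmetry type graph of a maniplex has the flag orbits of its automorphism group as vertices, with an edge of color $i$ between the orbits of $\Phi$ and $r_i\Phi$ (a semi-edge if equal). -}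

module Defs where

open import Level using (0ℓ)
open import Data.Nat using (ℕ; zero; suc; _+_; _≤_; _<_; ∣_-_∣)
open import Data.Nat.DivMod using (_%_; m%n<n)
open import Data.Fin using (Fin; zero; suc; toℕ; fromℕ<; opposite)
open import Data.Bool using (Bool; true; false; not)
open import Data.Product using (Σ; _×_; _,_; proj₁; proj₂)
open import Data.Sum using (_⊎_)
open import Data.List using (List; []; _∷_)
open import Data.List.Relation.Unary.All using (All)
open import Relation.Nullary using (¬_)
open import Relation.Binary using (Rel; IsEquivalence)
open import Relation.Binary.PropositionalEquality as P using (_≡_)

-- Edge-coloured graphs in which every vertex (flag) has exactly one edge
-- of each colour i : Fin n, given by the map x ↦ r i x (a fixed point of
-- r i is a semi-edge).  Flags carry a setoid equality (needed since the
-- flags of a derived graph involve automorphisms, compared pointwise).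

record ColGraph (n : ℕ) : Set₁ where
  field
    Flag          : Set
    _≈_           : Rel Flag 0ℓ
    isEquivalence : IsEquivalence _≈_
    r             : Fin n → Flag → Flag
    r-cong        : ∀ i {x y} → x ≈ y → r i x ≈ r i y

  open IsEquivalence isEquivalence public

open ColGraph public

module _ {n : ℕ} (G : ColGraph n) where
  private
    module G = ColGraph G

  walk : List (Fin n) → G.Flag → G.Flag
  walk []      x = x
  walk (i ∷ w) x = walk w (G.r i x)

  PathIn : (Fin n → Set) → G.Flag → G.Flag → Set
  PathIn S x y = Σ (List (Fin n)) λ w → All S w × G._≈_ (walk w x) y

  Connected : Set
  Connected = ∀ x y → PathIn (λ _ → Data.Unit.⊤) x y
    where import Data.Unit

  IsPremaniplex : Set
  IsPremaniplex =
      (∀ i x → G._≈_ (G.r i (G.r i x)) x)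
    × (∀ i j x → 1 < ∣ toℕ i - toℕ j ∣ →
         G._≈_ (G.r i (G.r j (G.r i (G.r j x)))) x)
    × Connected

  IsSimple : Set
  IsSimple = (∀ i x → ¬ G._≈_ (G.r i x) x)
           × (∀ i j x → G._≈_ (G.r i x) (G.r j x) → i ≡ j)

  IsManiplex : Set
  IsManiplex = IsPremaniplex × IsSimple

  -- abstract n-polytope (path / diamond-type intersection condition)
  IsPolytope : Set
  IsPolytope = IsManiplex ×
    (∀ (k m : ℕ) x y →
       PathIn (λ i → toℕ i ≤ m) x y →
       PathIn (λ i → k ≤ toℕ i) x y →
       PathIn (λ i → k ≤ toℕ i × toℕ i ≤ m) x y)

  record Aut : Set where
    field
      fun     : G.Flag → G.Flag
      inv     : G.Flag → G.Flag
      fun-cong : ∀ {x y} → G._≈_ x y → G._≈_ (fun x) (fun y)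
      inv-cong : ∀ {x y} → G._≈_ x y → G._≈_ (inv x) (inv y)
      inv-fun : ∀ x → G._≈_ (inv (fun x)) x
      fun-inv : ∀ x → G._≈_ (fun (inv x)) x
      fun-r   : ∀ i x → G._≈_ (fun (G.r i x)) (G.r i (fun x))

  open Aut public

  _⊙_ : G.Flag → Aut → G.Flag
  x ⊙ σ = fun σ x

  _≈A_ : Aut → Aut → Set
  σ ≈A τ = ∀ x → G._≈_ (fun σ x) (fun τ x)

  idAut : Aut
  idAut = record
    { fun = λ x → x ; inv = λ x → x
    ; fun-cong = λ p → p ; inv-cong = λ p → p
    ; inv-fun = λ x → G.refl ; fun-inv = λ x → G.refl
    ; fun-r = λ i x → G.refl }

  -- product with  Φ(στ) = (Φσ)τ
  _·_ : Aut → Aut → Aut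
  σ · τ = record
    { fun = λ x → fun τ (fun σ x)
    ; inv = λ x → inv σ (inv τ x)
    ; fun-cong = λ p → fun-cong τ (fun-cong σ p)
    ; inv-cong = λ p → inv-cong σ (inv-cong τ p)
    ; inv-fun = λ x → G.trans (inv-cong σ (inv-fun τ (fun σ x))) (inv-fun σ x)
    ; fun-inv = λ x → G.trans (fun-cong τ (fun-inv σ (inv τ x))) (fun-inv τ x)
    ; fun-r = λ i x → G.trans (fun-cong τ (fun-r σ i x)) (fun-r τ i (fun σ x))
    }

  _⁻¹ : Aut → Aut
  σ ⁻¹ = record
    { fun = inv σ ; inv = fun σ
    ; fun-cong = inv-cong σ ; inv-cong = fun-cong σ
    ; inv-fun = fun-inv σ ; fun-inv = inv-fun σ
    ; fun-r = λ i x →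
        G.trans (inv-cong σ (G.r-cong i (G.sym (fun-inv σ x))))
        (G.trans (inv-cong σ (G.sym (fun-r σ i (inv σ x))))
                 (inv-fun σ (G.r i (inv σ x))))
    }

  SameOrbit : G.Flag → G.Flag → Set
  SameOrbit x y = Σ Aut λ σ → G._≈_ (x ⊙ σ) y

  IsChiral : Set
  IsChiral =
      (Σ G.Flag λ x → Σ G.Flag λ y →
         ¬ SameOrbit x y × (∀ z → SameOrbit z x ⊎ SameOrbit z y))
    × (∀ i x → ¬ SameOrbit x (G.r i x))

record Iso {n : ℕ} (G H : ColGraph n) : Set where
  field
    to      : Flag G → Flag H
    from    : Flag H → Flag G
    to-cong   : ∀ {x y} → _≈_ G x y → _≈_ H (to x) (to y)
    from-cong : ∀ {x y} → _≈_ H x y → _≈_ G (from x) (from y)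
    from-to : ∀ x → _≈_ G (from (to x)) x
    to-from : ∀ y → _≈_ H (to (from y)) y
    to-r    : ∀ i x → _≈_ H (to (r G i x)) (r H i (to x))

Dual : {n : ℕ} → ColGraph n → ColGraph n
Dual G = record
  { Flag = Flag G ; _≈_ = _≈_ G ; isEquivalence = isEquivalence G
  ; r = λ i → r G (opposite i)
  ; r-cong = λ i → r-cong G (opposite i) }

SelfDual : {n : ℕ} → ColGraph n → Set
SelfDual G = Iso G (Dual G)

-- The symmetry type graph of G is isomorphic to H: a map from flags of G
-- to vertices of H, respecting equality, surjective, identifying exactly
-- the flags in the same Aut(G)-orbit, and sending colour-i edges to
-- colour-i edges (i.e. an isomorphism  Flags(G)/Aut(G) ≅ H).
record STGIsoTo {n : ℕ} (G H : ColGraph n) : Set where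
  field
    π       : Flag G → Flag H
    π-cong  : ∀ {x y} → _≈_ G x y → _≈_ H (π x) (π y)
    π-surj  : ∀ v → Σ (Flag G) λ x → _≈_ H (π x) v
    π-orbit⇒ : ∀ x y → SameOrbit G x y → _≈_ H (π x) (π y)
    π-orbit⇐ : ∀ x y → _≈_ H (π x) (π y) → SameOrbit G x y
    π-r     : ∀ i x → _≈_ H (π (r G i x)) (r H i (π x))

-- The voltage graph A_n (n = suc k).
-- Vertex (outer?, i, right?):  (true , i , false) = (r1 r0)^i a,
-- (true , i , true) = r0 (r1 r0)^i a; similarly with false for b.

XV : ℕ → Set
XV k = Bool × Fin (suc k) × Bool

nextF : ∀ {k} → Fin (suc k) → Fin (suc k)
nextF {k} i = fromℕ< (m%n<n (suc (toℕ i)) (suc k))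

prevF : ∀ {k} → Fin (suc k) → Fin (suc k)
prevF {k} i = fromℕ< (m%n<n (toℕ i + k) (suc k))

-- colour 0 inside a 1-face, colour 1 from the right flag of face i to
-- the left flag of face i+1, colour 2 between the two n-gons
rX : ∀ {k} → Fin 3 → XV k → XV k
rX zero          (s , i , e)     = (s , i , not e)
rX (suc zero)    (s , i , true)  = (s , nextF i , false)
rX (suc zero)    (s , i , false) = (s , prevF i , true)
rX (suc (suc _)) (s , i , e)     = (not s , i , not e)

XGraph : ℕ → ColGraph 3
XGraph k = record
  { Flag = XV k ; _≈_ = _≡_ ; isEquivalence = P.isEquivalence
  ; r = rX ; r-cong = λ i → P.cong (rX i) }

module _ {k : ℕ} (Pm : ColGraph (suc k)) (τ : Fin (suc k) → Aut Pm) where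

  ξ : Fin 3 → XV k → Aut Pm
  ξ (suc (suc _)) (true  , i , _) = τ i
  ξ (suc (suc _)) (false , i , _) = _⁻¹ Pm (τ i)
  ξ _             _               = idAut Pm

  -- derived graph: dart (d, γ) from (I d, γ) to (T d, ξ(d) γ)
  Derived : ColGraph 3
  Derived = record
    { Flag = XV k × Aut Pm
    ; _≈_ = λ { (v , γ) (w , δ) → v ≡ w × _≈A_ Pm γ δ }
    ; isEquivalence = record
        { refl = P.refl , (λ x → refl Pm)
        ; sym = λ { (p , q) → P.sym p , (λ x → sym Pm (q x)) }
        ; trans = λ { (p , q) (p' , q') → P.trans p p' , (λ x → trans Pm (q x) (q' x)) } }
    ; r = λ c → λ { (v , γ) → rX c v , _·_ Pm (ξ c v) γ }
    ; r-cong = λ { c {v , γ} {.v , δ} (P.refl , q) → P.refl , (λ x → q (fun (ξ c v) x)) }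
    }

{-# OPTIONS --safe #-}
module Submission where

-- Write a flag ((s, i, e), γ) of 𝒳^ξ as the pair (Φₛγ, (i, e)), where Φ_inner = Φ and Φ_outer = r₀Φ:
-- a flag of 𝒫 together with a flag of an n-gon. Since 𝒫 is chiral every flag of 𝒫 is uniquely of the
-- form Φₛγ, and in these coordinates colours 0 and 1 walk around the n-gon while colour 2 at the i-th
-- 1-face applies r_i to the flag of 𝒫. An automorphism of 𝒳^ξ then acts on the n-gon coordinate by a
-- dihedral symmetry, and on the 𝒫 coordinate by a bijection ε with ε r_i = r_{J i} ε, J the induced
-- permutation of 1-faces. Because r₀ and r_{n-1} commute whereas consecutive generators of a chiral
-- polytope never do, J is either the identity, in which case ε is an automorphism of 𝒫 and the
-- automorphism fixes the vertex of 𝒳, or i ↦ n-1-i, in which case ε is a duality. Hence if 𝒫 is not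
-- self-dual the orbits are exactly the fibres over the vertices of 𝒳; if it is, a duality induces an
-- automorphism moving every flag to another fibre, leaving fewer orbits than vertices of 𝒳.

open import Defs hiding (refl; sym; trans; reflexive)
open import Level using (0ℓ)
open import Data.Nat using (ℕ; suc; _+_; _*_; _≤_; _<_; z≤n; s≤s; ∣_-_∣; _%_)
open import Data.Nat.Properties
  using (m≤n⇒m<n∨m≡n; ≤-refl; ≤-trans; <-irrefl; ≰⇒>; n<1+n; n≤1+n; +-suc; <-≤-trans; _≤?_)
open import Data.Nat.DivMod using (m<n⇒m%n≡m; n%n≡0; [m+n]%n≡m%n)
open import Data.Fin using (Fin; zero; suc; toℕ; fromℕ; inject₁; opposite; punchOut; _≟_)
open import Data.Fin.Properties
  using (toℕ-injective; toℕ-fromℕ<; toℕ-fromℕ; toℕ-inject₁; toℕ<n; opposite-involutive;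
         any?; injective⇒≤; punchOut-injective; *↔×; 2↔Bool)
open import Data.Fin.Induction using (<-weakInduction)
open import Data.Fin.Relation.Unary.Top using (view; ‵fromℕ; ‵inject₁)
open import Data.Bool using (Bool; true; false; not; _xor_)
open import Data.Bool.Properties using (not-involutive; not-¬)
open import Data.List using (List; []; _∷_; _++_; _ʳ++_)
open import Data.List.Relation.Unary.All as All using (All; []; _∷_)
open import Data.Product using (Σ; ∃₂; _×_; _,_; proj₁; proj₂)
open import Data.Product.Relation.Binary.Pointwise.NonDependent using (Pointwise; ×-isEquivalence)
open import Data.Product.Function.NonDependent.Propositional using (_×-↔_)
open import Data.Sum using (_⊎_; inj₁; inj₂; [_,_]′)
open import Data.Empty using (⊥-elim)
open import Relation.Nullary using (¬_; yes; no; contradiction)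
open import Relation.Binary using (Setoid)
import Relation.Binary.Reasoning.Setoid as SetoidReasoning
open import Relation.Binary.PropositionalEquality as ≡
  using (_≡_; _≢_; refl; cong; cong₂; subst; subst₂; module ≡-Reasoning)
open import Function using (_∘_; _↔_; Inverse)
open import Function.Definitions using (Injective; StrictlySurjective)
open import Function.Bundles using (_⇔_; mk⇔)
open import Function.Properties.Inverse using (↔-sym; ↔-trans; ↔-refl)

module _ {k : ℕ} where
  open ≡-Reasoning

  nextF-fromℕ : nextF (fromℕ k) ≡ zero
  nextF-fromℕ = toℕ-injective (≡.trans (toℕ-fromℕ< _)
    (≡.trans (cong (λ t → suc t % suc k) (toℕ-fromℕ k)) (n%n≡0 (suc k))))

  nextF-inject₁ : (j : Fin k) → nextF (inject₁ j) ≡ suc j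
  nextF-inject₁ j = toℕ-injective (≡.trans (toℕ-fromℕ< _)
    (≡.trans (cong (λ t → suc t % suc k) (toℕ-inject₁ j)) (m<n⇒m%n≡m (s≤s (toℕ<n j)))))

  prevF-zero : prevF zero ≡ fromℕ k
  prevF-zero = toℕ-injective (≡.trans (toℕ-fromℕ< _)
    (≡.trans (m<n⇒m%n≡m (n<1+n k)) (≡.sym (toℕ-fromℕ k))))

  prevF-suc : (j : Fin k) → prevF (suc j) ≡ inject₁ j
  prevF-suc j = toℕ-injective (begin
    toℕ (prevF (suc j))           ≡⟨ toℕ-fromℕ< _ ⟩
    (suc (toℕ j) + k) % suc k     ≡⟨ cong (_% suc k) (+-suc (toℕ j) k) ⟨
    (toℕ j + suc k) % suc k       ≡⟨ [m+n]%n≡m%n (toℕ j) (suc k) ⟩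
    toℕ j % suc k                 ≡⟨ m<n⇒m%n≡m (<-≤-trans (toℕ<n j) (n≤1+n k)) ⟩
    toℕ j                         ≡⟨ toℕ-inject₁ j ⟨
    toℕ (inject₁ j)               ∎)

  prevF-nextF : (i : Fin (suc k)) → prevF (nextF i) ≡ i
  prevF-nextF i with view i
  ... | ‵fromℕ     = ≡.trans (cong prevF nextF-fromℕ) prevF-zero
  ... | ‵inject₁ j = ≡.trans (cong prevF (nextF-inject₁ j)) (prevF-suc j)

  nextF-prevF : (i : Fin (suc k)) → nextF (prevF i) ≡ i
  nextF-prevF zero    = ≡.trans (cong nextF prevF-zero) nextF-fromℕ
  nextF-prevF (suc j) = ≡.trans (cong nextF (prevF-suc j)) (nextF-inject₁ j)

  toℕ-nextF : (i : Fin (suc k)) → nextF i ≢ zero → toℕ (nextF i) ≡ suc (toℕ i)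
  toℕ-nextF i next≢0 with view i
  ... | ‵fromℕ     = contradiction nextF-fromℕ next≢0
  ... | ‵inject₁ j = ≡.trans (cong toℕ (nextF-inject₁ j)) (cong suc (≡.sym (toℕ-inject₁ j)))

  nextF-induction : (P : Fin (suc k) → Set) → P zero → (∀ i → P i → P (nextF i)) → ∀ i → P i
  nextF-induction P P₀ step =
    <-weakInduction P P₀ (λ j Pj → subst P (nextF-inject₁ j) (step (inject₁ j) Pj))

  opposite-inject₁ : (j : Fin k) → opposite (inject₁ j) ≡ suc (opposite j)
  opposite-inject₁ j = ≡.trans (cong (λ i → opposite (inject₁ i)) (≡.sym (opposite-involutive j)))
                               (opposite-involutive (suc (opposite j)))

  opposite-nextF : (i : Fin (suc k)) → opposite (nextF i) ≡ prevF (opposite i)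
  opposite-nextF i with view i
  ... | ‵fromℕ     = ≡.trans (cong opposite nextF-fromℕ)
                           (≡.sym (≡.trans (cong prevF (opposite-involutive zero)) prevF-zero))
  ... | ‵inject₁ j = ≡.trans (cong opposite (nextF-inject₁ j))
                           (≡.sym (≡.trans (cong prevF (opposite-inject₁ j)) (prevF-suc (opposite j))))

  opposite-prevF : (i : Fin (suc k)) → opposite (prevF i) ≡ nextF (opposite i)
  opposite-prevF i = ≡.trans (≡.sym (nextF-prevF (opposite (prevF i))))
    (cong nextF (≡.trans (≡.sym (opposite-nextF (prevF i))) (cong opposite (nextF-prevF i))))

  rotate : ℕ → Fin (suc k) → Fin (suc k)
  rotate 0       i = i
  rotate (suc t) i = nextF (rotate t i)

  rotate-nextF : ∀ t (i : Fin (suc k)) → rotate t (nextF i) ≡ nextF (rotate t i)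
  rotate-nextF 0       i = refl
  rotate-nextF (suc t) i = cong nextF (rotate-nextF t i)

  rotate-prevF : ∀ t (i : Fin (suc k)) → rotate t (prevF i) ≡ prevF (rotate t i)
  rotate-prevF t i = ≡.trans (≡.sym (prevF-nextF (rotate t (prevF i))))
    (cong prevF (≡.trans (≡.sym (rotate-nextF t (prevF i))) (cong (rotate t) (nextF-prevF i))))

  rotate-zero : (c : Fin (suc k)) → rotate (toℕ c) zero ≡ c
  rotate-zero = <-weakInduction (λ c → rotate (toℕ c) zero ≡ c) refl step
    where
    step : ∀ j → rotate (toℕ (inject₁ j)) zero ≡ inject₁ j → rotate (toℕ (suc j)) zero ≡ suc j
    step j ih = begin
      nextF (rotate (toℕ j) zero)            ≡⟨ cong (λ t → nextF (rotate t zero)) (toℕ-inject₁ j) ⟨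
      nextF (rotate (toℕ (inject₁ j)) zero)  ≡⟨ cong nextF ih ⟩
      nextF (inject₁ j)                      ≡⟨ nextF-inject₁ j ⟩
      suc j                                  ∎

  reflect : ℕ → Fin (suc k) → Fin (suc k)
  reflect t i = opposite (rotate t i)

  reflect-nextF : ∀ t (i : Fin (suc k)) → reflect t (nextF i) ≡ prevF (reflect t i)
  reflect-nextF t i = ≡.trans (cong opposite (rotate-nextF t i)) (opposite-nextF (rotate t i))

  reflect-prevF : ∀ t (i : Fin (suc k)) → reflect t (prevF i) ≡ nextF (reflect t i)
  reflect-prevF t i = ≡.trans (cong opposite (rotate-prevF t i)) (opposite-prevF (rotate t i))

  module _ (J : Fin (suc k) → Fin (suc k)) where

    private
      J-zero : J zero ≡ J (nextF (fromℕ k))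
      J-zero = cong J (≡.sym nextF-fromℕ)

    rotation-classification : (∀ i → J (nextF i) ≡ nextF (J i)) →
                              J zero ≡ zero ⊎ toℕ (J zero) ≡ suc (toℕ (J (fromℕ k)))
    rotation-classification J-nextF with J zero ≟ zero
    ... | yes J₀≡0 = inj₁ J₀≡0
    ... | no  J₀≢0 =
      inj₂ (≡.trans (cong toℕ J₀≡next) (toℕ-nextF _ (λ e → J₀≢0 (≡.trans J₀≡next e))))
      where
      J₀≡next : J zero ≡ nextF (J (fromℕ k))
      J₀≡next = ≡.trans J-zero (J-nextF (fromℕ k))

    reflection-classification : (∀ i → J (nextF i) ≡ prevF (J i)) →
                                (∀ i → J i ≡ opposite i) ⊎ toℕ (J (fromℕ k)) ≡ suc (toℕ (J zero))
    reflection-classification J-nextF with J (fromℕ k) ≟ zero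
    ... | yes Jₖ≡0 = inj₁ (nextF-induction (λ i → J i ≡ opposite i) J₀≡opposite step)
      where
      J₀≡opposite : J zero ≡ opposite zero
      J₀≡opposite = begin
        J zero                ≡⟨ ≡.trans J-zero (J-nextF (fromℕ k)) ⟩
        prevF (J (fromℕ k))   ≡⟨ cong prevF Jₖ≡0 ⟩
        prevF zero            ≡⟨ prevF-zero ⟩
        fromℕ k               ∎
      step : ∀ i → J i ≡ opposite i → J (nextF i) ≡ opposite (nextF i)
      step i Jᵢ≡opposite = begin
        J (nextF i)           ≡⟨ J-nextF i ⟩
        prevF (J i)           ≡⟨ cong prevF Jᵢ≡opposite ⟩
        prevF (opposite i)    ≡⟨ opposite-nextF i ⟨
        opposite (nextF i)    ∎
    ... | no  Jₖ≢0 =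
      inj₂ (≡.trans (cong toℕ Jₖ≡next) (toℕ-nextF _ (λ e → Jₖ≢0 (≡.trans Jₖ≡next e))))
      where
      Jₖ≡next : J (fromℕ k) ≡ nextF (J zero)
      Jₖ≡next = ≡.trans (≡.sym (nextF-prevF _))
                        (cong nextF (≡.sym (≡.trans J-zero (J-nextF (fromℕ k)))))

Fin-injective⇒surjective : ∀ {N} (g : Fin N → Fin N) →
                           Injective _≡_ _≡_ g → StrictlySurjective _≡_ g
Fin-injective⇒surjective {suc N} g g-injective y with any? (λ x → g x ≟ y)
... | yes hit  = hit
... | no  miss = contradiction (injective⇒≤ punchOut∘g-injective) (<-irrefl refl)
  where
  avoid : ∀ x → y ≢ g x
  avoid x y≡gx = miss (x , ≡.sym y≡gx)
  punchOut∘g-injective : Injective _≡_ _≡_ (λ x → punchOut (avoid x))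
  punchOut∘g-injective eq = g-injective (punchOut-injective (avoid _) (avoid _) eq)

Fin-surjective⇒injective : ∀ {N} (f : Fin N → Fin N) →
                           StrictlySurjective _≡_ f → Injective _≡_ _≡_ f
Fin-surjective⇒injective f f-surjective {a} {b} fa≡fb = begin
  a          ≡⟨ g∘f a ⟨
  g (f a)    ≡⟨ cong g fa≡fb ⟩
  g (f b)    ≡⟨ g∘f b ⟩
  b          ∎
  where
  open ≡-Reasoning
  g : Fin _ → Fin _
  g y = proj₁ (f-surjective y)
  f∘g : ∀ y → f (g y) ≡ y
  f∘g y = proj₂ (f-surjective y)
  g-injective : Injective _≡_ _≡_ g
  g-injective {y} {y′} gy≡gy′ = ≡.trans (≡.sym (f∘g y)) (≡.trans (cong f gy≡gy′) (f∘g y′))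
  g∘f : ∀ x → g (f x) ≡ x
  g∘f x = let (y , gy≡x) = Fin-injective⇒surjective g g-injective x in
    ≡.trans (cong (g ∘ f) (≡.sym gy≡x)) (≡.trans (cong g (f∘g y)) gy≡x)

finite-surjective⇒injective : ∀ {A : Set} {N} → A ↔ Fin N → (f : A → A) →
                              StrictlySurjective _≡_ f → Injective _≡_ _≡_ f
finite-surjective⇒injective A↔Fin f f-surjective {a} {b} fa≡fb = begin
  a              ≡⟨ strictlyInverseʳ a ⟨
  from (to a)    ≡⟨ cong from (Fin-surjective⇒injective F F-surjective F-to-a≡F-to-b) ⟩
  from (to b)    ≡⟨ strictlyInverseʳ b ⟩
  b              ∎
  where
  open ≡-Reasoning
  open Inverse A↔Fin
  F : Fin _ → Fin _
  F = to ∘ f ∘ from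
  F-to : ∀ x → F (to x) ≡ to (f x)
  F-to x = cong (to ∘ f) (strictlyInverseʳ x)
  F-surjective : StrictlySurjective _≡_ F
  F-surjective y = let (x , fx≡from-y) = f-surjective (from y) in
    to x , ≡.trans (F-to x) (≡.trans (cong to fx≡from-y) (strictlyInverseˡ y))
  F-to-a≡F-to-b : F (to a) ≡ F (to b)
  F-to-a≡F-to-b = ≡.trans (F-to a) (≡.trans (cong to fa≡fb) (≡.sym (F-to b)))

setoid : ∀ {n} → ColGraph n → Setoid 0ℓ 0ℓ
setoid G = record { isEquivalence = isEquivalence G }

Commute : ∀ {n} → ColGraph n → Fin n → Fin n → Set
Commute G i j = ∀ x → _≈_ G (r G i (r G j x)) (r G j (r G i x))

Recolour : ∀ {n} → ColGraph n → (Fin n → Fin n) → ColGraph n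
Recolour G J = record
  { Flag = Flag G ; _≈_ = _≈_ G ; isEquivalence = isEquivalence G
  ; r = λ i → r G (J i) ; r-cong = λ i → r-cong G (J i) }

module _ {n : ℕ} (G : ColGraph n) where
  private
    module G = ColGraph G

  Commute-sym : ∀ {i j} → Commute G i j → Commute G j i
  Commute-sym ij x = G.sym (ij x)

  walk-cong : ∀ U {x y} → x G.≈ y → walk G U x G.≈ walk G U y
  walk-cong []      x≈y = x≈y
  walk-cong (i ∷ U) x≈y = walk-cong U (G.r-cong i x≈y)

  walk-++ : ∀ U V x → walk G (U ++ V) x ≡ walk G V (walk G U x)
  walk-++ []      V x = refl
  walk-++ (i ∷ U) V x = walk-++ U V (G.r i x)

  fun-walk : (σ : Aut G) → ∀ U x → fun σ (walk G U x) G.≈ walk G U (fun σ x)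
  fun-walk σ []      x = G.refl
  fun-walk σ (i ∷ U) x = G.trans (fun-walk σ U (G.r i x)) (walk-cong U (fun-r σ i x))

  walk-r-commute : ∀ {b} U → All (λ a → Commute G a b) U →
                   ∀ x → walk G U (G.r b x) G.≈ G.r b (walk G U x)
  walk-r-commute []      []         x = G.refl
  walk-r-commute (a ∷ U) (ab ∷ Uab) x = G.trans (walk-cong U (ab x)) (walk-r-commute U Uab (G.r a x))

  sameOrbit-sym : ∀ {x y} → SameOrbit G x y → SameOrbit G y x
  sameOrbit-sym {x} (σ , xσ≈y) = _⁻¹ G σ , G.trans (inv-cong σ (G.sym xσ≈y)) (inv-fun σ x)

  sameOrbit-trans : ∀ {x y z} → SameOrbit G x y → SameOrbit G y z → SameOrbit G x z
  sameOrbit-trans (σ , xσ≈y) (τ , yτ≈z) = _·_ G σ τ , G.trans (fun-cong τ xσ≈y) yτ≈z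

  closed-sameOrbit : ∀ {x y} U → SameOrbit G x y → walk G U x G.≈ x → walk G U y G.≈ y
  closed-sameOrbit {x} {y} U (σ , xσ≈y) closed = begin
    walk G U y            ≈⟨ walk-cong U xσ≈y ⟨
    walk G U (fun σ x)    ≈⟨ fun-walk σ U x ⟨
    fun σ (walk G U x)    ≈⟨ fun-cong σ closed ⟩
    fun σ x               ≈⟨ xσ≈y ⟩
    y                     ∎
    where open SetoidReasoning (setoid G)

  aut-unique : Connected G → (σ τ : Aut G) → ∀ x → fun σ x G.≈ fun τ x → _≈A_ G σ τ
  aut-unique conn σ τ x σx≈τx y = begin
    fun σ y               ≈⟨ fun-cong σ w ⟨
    fun σ (walk G W x)    ≈⟨ fun-walk σ W x ⟩
    walk G W (fun σ x)    ≈⟨ walk-cong W σx≈τx ⟩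
    walk G W (fun τ x)    ≈⟨ fun-walk τ W x ⟨
    fun τ (walk G W x)    ≈⟨ fun-cong τ w ⟩
    fun τ y               ∎
    where
    open SetoidReasoning (setoid G)
    W = proj₁ (conn x y)
    w = proj₂ (proj₂ (conn x y))

  module _ (r-involutive : ∀ i x → G.r i (G.r i x) G.≈ x) where

    walk-injective : ∀ U {x y} → walk G U x G.≈ walk G U y → x G.≈ y
    walk-injective []      p = p
    walk-injective (i ∷ U) {x} {y} p = G.trans (G.sym (r-involutive i x))
      (G.trans (G.r-cong i (walk-injective U p)) (r-involutive i y))

    walk-ʳ++ : ∀ U V x → walk G (U ʳ++ V) (walk G U x) G.≈ walk G V x
    walk-ʳ++ []      V x = G.refl
    walk-ʳ++ (i ∷ U) V x = G.trans (walk-ʳ++ U (i ∷ V) (G.r i x)) (walk-cong V (r-involutive i x))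

    PathIn-sym : ∀ {S x y} → PathIn G S x y → PathIn G S y x
    PathIn-sym {x = x} (U , SU , Ux≈y) =
      U ʳ++ [] , All-ʳ++ SU [] , G.trans (walk-cong (U ʳ++ []) (G.sym Ux≈y)) (walk-ʳ++ U [] x)
      where
      All-ʳ++ : ∀ {S : Fin n → Set} {U V} → All S U → All S V → All S (U ʳ++ V)
      All-ʳ++ []         SV = SV
      All-ʳ++ (Si ∷ SU)  SV = All-ʳ++ SU (Si ∷ SV)

    closed⇒agreeing : ∀ {z z'} → (∀ U → walk G U z G.≈ z → walk G U z' G.≈ z') →
                      ∀ U V → walk G U z G.≈ walk G V z → walk G U z' G.≈ walk G V z'
    closed⇒agreeing {z} {z'} z⇒z' U V UV = walk-injective (V ʳ++ []) (begin
      walk G (V ʳ++ []) (walk G U z')   ≡⟨ walk-++ U (V ʳ++ []) z' ⟨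
      walk G (U ++ V ʳ++ []) z'         ≈⟨ z⇒z' (U ++ V ʳ++ []) closed ⟩
      z'                                ≈⟨ walk-ʳ++ V [] z' ⟨
      walk G (V ʳ++ []) (walk G V z')   ∎)
      where
      open SetoidReasoning (setoid G)
      closed : walk G (U ++ V ʳ++ []) z G.≈ z
      closed = begin
        walk G (U ++ V ʳ++ []) z          ≡⟨ walk-++ U (V ʳ++ []) z ⟩
        walk G (V ʳ++ []) (walk G U z)    ≈⟨ walk-cong (V ʳ++ []) UV ⟩
        walk G (V ʳ++ []) (walk G V z)    ≈⟨ walk-ʳ++ V [] z ⟩
        z                                 ∎

    closedWords⇒sameOrbit : Connected G → ∀ g h →
      (∀ U → walk G U g G.≈ g → walk G U h G.≈ h) →
      (∀ U → walk G U h G.≈ h → walk G U g G.≈ g) → SameOrbit G g h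
    closedWords⇒sameOrbit conn g h g⇒h h⇒g = σ , g.map-walk [] g G.refl
      where
      module Transport {z z'} (z⇒z' : ∀ U → walk G U z G.≈ z → walk G U z' G.≈ z') where
        route : G.Flag → List (Fin n)
        route x = proj₁ (conn z x)

        route-walk : ∀ x → walk G (route x) z G.≈ x
        route-walk x = proj₂ (proj₂ (conn z x))

        map : G.Flag → G.Flag
        map x = walk G (route x) z'

        map-walk : ∀ U x → walk G U z G.≈ x → map x G.≈ walk G U z'
        map-walk U x Uz≈x = closed⇒agreeing z⇒z' (route x) U (G.trans (route-walk x) (G.sym Uz≈x))

        map-cong : ∀ {x y} → x G.≈ y → map x G.≈ map y
        map-cong {x} {y} x≈y = map-walk (route y) x (G.trans (route-walk y) (G.sym x≈y))

      module g = Transport g⇒h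
      module h = Transport h⇒g

      σ : Aut G
      σ = record
        { fun = g.map ; inv = h.map ; fun-cong = g.map-cong ; inv-cong = h.map-cong
        ; inv-fun = λ x → G.trans (h.map-walk (g.route x) (g.map x) G.refl) (g.route-walk x)
        ; fun-inv = λ x → G.trans (g.map-walk (h.route x) (h.map x) G.refl) (h.route-walk x)
        ; fun-r = λ i x → let U = g.route x in
            G.trans (g.map-walk (U ++ i ∷ []) (G.r i x)
                      (G.trans (G.reflexive (walk-++ U (i ∷ []) g)) (G.r-cong i (g.route-walk x))))
                    (G.reflexive (walk-++ U (i ∷ []) h)) }

module _ {n : ℕ} {G H : ColGraph n} (I : Iso G H) where
  private
    module G = ColGraph G
    module H = ColGraph H
  open Iso I

  from-r : ∀ i y → from (H.r i y) G.≈ G.r i (from y)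
  from-r i y = G.trans (from-cong (H.r-cong i (H.sym (to-from y))))
                 (G.trans (from-cong (H.sym (to-r i (from y)))) (from-to (G.r i (from y))))

  Iso-sym : Iso H G
  Iso-sym = record
    { to = from ; from = to ; to-cong = from-cong ; from-cong = to-cong
    ; from-to = to-from ; to-from = from-to ; to-r = from-r }

  to-walk : ∀ U x → to (walk G U x) H.≈ walk H U (to x)
  to-walk []      x = H.refl
  to-walk (i ∷ U) x = H.trans (to-walk U (G.r i x)) (walk-cong H U (to-r i x))

  Iso⇒Connected : Connected G → Connected H
  Iso⇒Connected conn x y = U , trivial , (begin
    walk H U x                ≈⟨ walk-cong H U (to-from x) ⟨
    walk H U (to (from x))    ≈⟨ to-walk U (from x) ⟨
    to (walk G U (from x))    ≈⟨ to-cong U-from ⟩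
    to (from y)               ≈⟨ to-from y ⟩
    y                         ∎)
    where
    open SetoidReasoning (setoid H)
    U = proj₁ (conn (from x) (from y))
    trivial = proj₁ (proj₂ (conn (from x) (from y)))
    U-from = proj₂ (proj₂ (conn (from x) (from y)))

  Iso⇒Commute : ∀ {i j} → Commute G i j → Commute H i j
  Iso⇒Commute {i} {j} ij y = begin
    H.r i (H.r j y)                   ≈⟨ H.r-cong i (H.r-cong j (to-from y)) ⟨
    H.r i (H.r j (to (from y)))       ≈⟨ H.r-cong i (to-r j (from y)) ⟨
    H.r i (to (G.r j (from y)))       ≈⟨ to-r i (G.r j (from y)) ⟨
    to (G.r i (G.r j (from y)))       ≈⟨ to-cong (ij (from y)) ⟩
    to (G.r j (G.r i (from y)))       ≈⟨ to-r j (G.r i (from y)) ⟩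
    H.r j (to (G.r i (from y)))       ≈⟨ H.r-cong j (to-r i (from y)) ⟩
    H.r j (H.r i (to (from y)))       ≈⟨ H.r-cong j (H.r-cong i (to-from y)) ⟩
    H.r j (H.r i y)                   ∎
    where open SetoidReasoning (setoid H)

  conjAut : Aut G → Aut H
  conjAut σ = record
    { fun = λ y → to (fun σ (from y))
    ; inv = λ y → to (inv σ (from y))
    ; fun-cong = λ p → to-cong (fun-cong σ (from-cong p))
    ; inv-cong = λ p → to-cong (inv-cong σ (from-cong p))
    ; inv-fun = λ y → H.trans (to-cong (inv-cong σ (from-to (fun σ (from y)))))
                        (H.trans (to-cong (inv-fun σ (from y))) (to-from y))
    ; fun-inv = λ y → H.trans (to-cong (fun-cong σ (from-to (inv σ (from y)))))
                        (H.trans (to-cong (fun-inv σ (from y))) (to-from y))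
    ; fun-r = λ i y → H.trans (to-cong (fun-cong σ (from-r i y)))
                        (H.trans (to-cong (fun-r σ i (from y))) (to-r i (fun σ (from y))))
    }

  to-conjAut : ∀ σ x → fun (conjAut σ) (to x) H.≈ to (fun σ x)
  to-conjAut σ x = to-cong (fun-cong σ (from-to x))

Iso⇒Aut : ∀ {n} {G : ColGraph n} → Iso G G → Aut G
Iso⇒Aut I = record
  { fun = to ; inv = from ; fun-cong = to-cong ; inv-cong = from-cong
  ; inv-fun = from-to ; fun-inv = to-from ; fun-r = to-r }
  where open Iso I

Iso-Recolour-cong : ∀ {n} {G H : ColGraph n} {J J′ : Fin n → Fin n} → (∀ i → J i ≡ J′ i) →
                    Iso G (Recolour H J) → Iso G (Recolour H J′)
Iso-Recolour-cong {H = H} J≗J′ I = record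
  { to = to ; from = from ; to-cong = to-cong ; from-cong = from-cong
  ; from-to = from-to ; to-from = to-from
  ; to-r = λ i x → H.trans (to-r i x) (H.reflexive (cong (λ j → H.r j (to x)) (J≗J′ i))) }
  where
  module H = ColGraph H
  open Iso I

module _ {n : ℕ} {P : ColGraph n} (chiral : IsChiral P) where
  private
    module P = ColGraph P

  two-orbits : ∀ {x y} → ¬ SameOrbit P x y → ∀ z → SameOrbit P x z ⊎ SameOrbit P y z
  two-orbits {x} {y} x≁y z with proj₁ chiral
  ... | _ , _ , _ , cover with cover x | cover y | cover z
  ... | inj₁ xa | inj₁ ya | _       = ⊥-elim (x≁y (sameOrbit-trans P xa (sameOrbit-sym P ya)))
  ... | inj₂ xb | inj₂ yb | _       = ⊥-elim (x≁y (sameOrbit-trans P xb (sameOrbit-sym P yb)))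
  ... | inj₁ xa | _       | inj₁ za = inj₁ (sameOrbit-trans P xa (sameOrbit-sym P za))
  ... | inj₂ xb | _       | inj₂ zb = inj₁ (sameOrbit-trans P xb (sameOrbit-sym P zb))
  ... | inj₁ _  | inj₂ yb | inj₂ zb = inj₂ (sameOrbit-trans P yb (sameOrbit-sym P zb))
  ... | inj₂ _  | inj₁ ya | inj₁ za = inj₂ (sameOrbit-trans P ya (sameOrbit-sym P za))

  sameOrbit-r-r : ∀ i j x → SameOrbit P x (P.r i (P.r j x))
  sameOrbit-r-r i j x with two-orbits (proj₂ chiral j x) (P.r i (P.r j x))
  ... | inj₁ x~rirjx  = x~rirjx
  ... | inj₂ rjx~rirjx = ⊥-elim (proj₂ chiral i (P.r j x) rjx~rirjx)

2+m≤n⇒1<∣m-n∣ : ∀ m n → suc (suc m) ≤ n → 1 < ∣ m - n ∣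
2+m≤n⇒1<∣m-n∣ 0       (suc (suc n)) (s≤s (s≤s _)) = s≤s (s≤s z≤n)
2+m≤n⇒1<∣m-n∣ (suc m) (suc n)       (s≤s 2+m≤n) = 2+m≤n⇒1<∣m-n∣ m n 2+m≤n

far-commute : ∀ {n} {G : ColGraph n} → IsPremaniplex G → ∀ {i j} → 1 < ∣ toℕ i - toℕ j ∣ → Commute G i j
far-commute {G = G} (r-involutive , square , _) {i} {j} far x = begin
  G.r i (G.r j x)                                  ≈⟨ G.r-cong i (G.r-cong j cancel) ⟨
  G.r i (G.r j (G.r i (G.r j (G.r j (G.r i x)))))  ≈⟨ square i j (G.r j (G.r i x)) far ⟩
  G.r j (G.r i x)                                  ∎
  where
  module G = ColGraph G
  open SetoidReasoning (setoid G)
  cancel : G.r i (G.r j (G.r j (G.r i x))) G.≈ x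
  cancel = G.trans (G.r-cong i (r-involutive j (G.r i x))) (r-involutive i x)

module _ {n : ℕ} {P : ColGraph n} (polytope : IsPolytope P) (chiral : IsChiral P) where
  private
    module P = ColGraph P
    premaniplex = proj₁ (proj₁ polytope)
    r-involutive = proj₁ premaniplex
    connected = proj₂ (proj₂ premaniplex)
    intersection = proj₂ polytope

  private module Consecutive (p q : Fin n) (q≡1+p : toℕ q ≡ suc (toℕ p)) (pq : Commute P p q) where
    private
      Low High : Fin n → Set
      Low i = toℕ i ≤ toℕ p
      High i = toℕ q ≤ toℕ i

      low-high-commute : ∀ {a b} → Low a → High b → Commute P a b
      low-high-commute {a} {b} a≤p q≤b with m≤n⇒m<n∨m≡n a≤p | m≤n⇒m<n∨m≡n q≤b
      ... | inj₁ a<p | _ = far-commute {G = P} premaniplex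
        (2+m≤n⇒1<∣m-n∣ _ _ (≤-trans (s≤s a<p) (subst (_≤ toℕ b) q≡1+p q≤b)))
      ... | inj₂ a≡p | inj₁ q<b = far-commute {G = P} premaniplex (2+m≤n⇒1<∣m-n∣ _ _
        (subst (λ t → suc (suc t) ≤ toℕ b) (≡.sym a≡p) (subst (λ t → suc t ≤ toℕ b) q≡1+p q<b)))
      ... | inj₂ a≡p | inj₂ q≡b = subst₂ (Commute P) (toℕ-injective (≡.sym a≡p)) (toℕ-injective q≡b) pq

      low-commute : ∀ {A b} → All Low A → High b → All (λ a → Commute P a b) A
      low-commute lowA q≤b = All.map (λ a≤p → low-high-commute a≤p q≤b) lowA

      high-commute : ∀ {B a} → All High B → Low a → All (λ b → Commute P b a) B
      high-commute highB a≤p = All.map (λ q≤b → Commute-sym P (low-high-commute a≤p q≤b)) highB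

      split-low-high : ∀ U → ∃₂ λ A B → All Low A × All High B ×
                                        (∀ x → walk P U x P.≈ walk P B (walk P A x))
      split-low-high []      = [] , [] , [] , [] , λ x → P.refl
      split-low-high (i ∷ U) with split-low-high U | toℕ i ≤? toℕ p
      ... | A , B , lowA , highB , split | yes i≤p = i ∷ A , B , i≤p ∷ lowA , highB , λ x → split (P.r i x)
      ... | A , B , lowA , highB , split | no  i≰p = A , i ∷ B , lowA , q≤i ∷ highB , λ x →
            P.trans (split (P.r i x)) (walk-cong P B (walk-r-commute P A (low-commute lowA q≤i) x))
        where
        q≤i : toℕ q ≤ toℕ i
        q≤i = subst (_≤ toℕ i) (≡.sym q≡1+p) (≰⇒> i≰p)

      low-closed : ∀ {A B} x → All Low A → All High B → walk P B (walk P A x) P.≈ x → walk P A x P.≈ x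
      low-closed {A} {B} x lowA highB BAx≈x
        with intersection (toℕ q) (toℕ p) (walk P A x) x
               (PathIn-sym P r-involutive (A , lowA , P.refl)) (B , highB , BAx≈x)
      ... | []    , []                , Ax≈x = Ax≈x
      ... | _ ∷ _ , (q≤i , i≤p) ∷ _ , _    =
        ⊥-elim (<-irrefl refl (subst (_≤ toℕ p) q≡1+p (≤-trans q≤i i≤p)))

    closed-at-r : ∀ x U → walk P U x P.≈ x → walk P U (P.r q x) P.≈ P.r q x
    closed-at-r x U Ux≈x with split-low-high U
    ... | A , B , lowA , highB , split = begin
      walk P U y               ≈⟨ split y ⟩
      walk P B (walk P A y)    ≈⟨ walk-cong P B Ay≈y ⟩
      walk P B y               ≈⟨ By≈y ⟩
      y                        ∎
      where
      open SetoidReasoning (setoid P)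
      y = P.r q x
      BAx≈x : walk P B (walk P A x) P.≈ x
      BAx≈x = P.trans (P.sym (split x)) Ux≈x
      Ax≈x : walk P A x P.≈ x
      Ax≈x = low-closed x lowA highB BAx≈x
      Bx≈x : walk P B x P.≈ x
      Bx≈x = P.trans (walk-cong P B (P.sym Ax≈x)) BAx≈x
      Ay≈y : walk P A y P.≈ y
      Ay≈y = P.trans (walk-r-commute P A (low-commute lowA ≤-refl) x) (P.r-cong q Ax≈x)
      By≈y : walk P B y P.≈ y
      By≈y = walk-injective P r-involutive (p ∷ []) (P.trans
        (P.sym (walk-r-commute P B (high-commute highB ≤-refl) y))
        (closed-sameOrbit P B (sameOrbit-r-r chiral p q x) Bx≈x))

  -- Splitting a closed word into its colours ≤ p and ≥ q, the intersection property closes both parts,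
  -- so every word closed at a flag is closed at its q-neighbour, which then lies in the same orbit.
  consecutive-noncommuting : ∀ p q → toℕ q ≡ suc (toℕ p) → ¬ Commute P p q
  consecutive-noncommuting p q q≡1+p pq = proj₂ chiral q g
    (closedWords⇒sameOrbit P r-involutive connected g (P.r q g) (closed-at-r g) closed-at-r⁻¹)
    where
    open Consecutive p q q≡1+p pq
    g = proj₁ (proj₁ chiral)
    closed-at-r⁻¹ : ∀ U → walk P U (P.r q g) P.≈ P.r q g → walk P U g P.≈ g
    closed-at-r⁻¹ U closed = P.trans (walk-cong P U (P.sym (r-involutive q g)))
      (P.trans (closed-at-r (P.r q g) U closed) (r-involutive q g))

Pos : ℕ → Set
Pos k = Fin (suc k) × Bool

basePos : ∀ {k} → Pos k
basePos = zero , false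

posR : ∀ {k} → Fin 3 → Pos k → Pos k
posR zero          (i , e)     = i , not e
posR (suc zero)    (i , true)  = nextF i , false
posR (suc zero)    (i , false) = prevF i , true
posR (suc (suc _)) (i , e)     = i , not e

-- 𝒳 with its two n-gons identified: colour 2 acts like colour 0.
PosGraph : ℕ → ColGraph 3
PosGraph k = record
  { Flag = Pos k ; _≈_ = _≡_ ; isEquivalence = ≡.isEquivalence
  ; r = posR ; r-cong = λ i → cong (posR i) }

module _ {k : ℕ} where

  faceMap : Pos k → Fin (suc k) → Fin (suc k)
  faceMap (c , false) = rotate (toℕ c)
  faceMap (c , true)  = reflect (toℕ (opposite c))

  dihedral : Pos k → Pos k → Pos k
  dihedral u (i , e) = faceMap u i , proj₂ u xor e

  dihedral-basePos : ∀ u → dihedral u basePos ≡ u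
  dihedral-basePos (c , false) = cong (_, false) (rotate-zero c)
  dihedral-basePos (c , true)  =
    cong (_, true) (≡.trans (cong opposite (rotate-zero (opposite c))) (opposite-involutive c))

  dihedral-posR : ∀ u c p → dihedral u (posR c p) ≡ posR c (dihedral u p)
  dihedral-posR (c , false) zero          p           = refl
  dihedral-posR (c , true)  zero          p           = refl
  dihedral-posR (c , false) (suc (suc _)) p           = refl
  dihedral-posR (c , true)  (suc (suc _)) p           = refl
  dihedral-posR (c , false) (suc zero)    (i , true)  = cong (_, false) (rotate-nextF (toℕ c) i)
  dihedral-posR (c , false) (suc zero)    (i , false) = cong (_, true) (rotate-prevF (toℕ c) i)
  dihedral-posR (c , true)  (suc zero)    (i , true)  = cong (_, true) (reflect-nextF (toℕ (opposite c)) i)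
  dihedral-posR (c , true)  (suc zero)    (i , false) = cong (_, false) (reflect-prevF (toℕ (opposite c)) i)

  dihedral-walk : ∀ u W p → dihedral u (walk (PosGraph k) W p) ≡ walk (PosGraph k) W (dihedral u p)
  dihedral-walk u []      p = refl
  dihedral-walk u (c ∷ W) p =
    ≡.trans (dihedral-walk u W (posR c p)) (cong (walk (PosGraph k) W) (dihedral-posR u c p))

module _ {k : ℕ} (P : ColGraph (suc k)) where
  private
    module P = ColGraph P

  bundleR : Fin 3 → P.Flag × Pos k → P.Flag × Pos k
  bundleR (suc (suc _)) (y , i , e) = P.r i y , i , not e
  bundleR c             (y , p)     = y , posR c p

  Bundle : ColGraph 3
  Bundle = record
    { Flag = P.Flag × Pos k ; _≈_ = Pointwise P._≈_ _≡_
    ; isEquivalence = ×-isEquivalence P.isEquivalence ≡.isEquivalence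
    ; r = bundleR ; r-cong = bundleR-cong }
    where
    bundleR-cong : ∀ c {x x′} → Pointwise P._≈_ _≡_ x x′ →
                   Pointwise P._≈_ _≡_ (bundleR c x) (bundleR c x′)
    bundleR-cong zero                        (y≈y′ , refl) = y≈y′ , refl
    bundleR-cong (suc zero)                  (y≈y′ , refl) = y≈y′ , refl
    bundleR-cong (suc (suc _)) {_ , i , _} (y≈y′ , refl) = P.r-cong i y≈y′ , refl

  proj₂-walk : ∀ W x → proj₂ (walk Bundle W x) ≡ walk (PosGraph k) W (proj₂ x)
  proj₂-walk []                x = refl
  proj₂-walk (zero ∷ W)        x = proj₂-walk W (bundleR zero x)
  proj₂-walk (suc zero ∷ W)    x = proj₂-walk W (bundleR (suc zero) x)
  proj₂-walk (suc (suc c) ∷ W) x = proj₂-walk W (bundleR (suc (suc c)) x)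

  positionAction : Connected Bundle → (β : Aut Bundle) → ∀ y x →
                   proj₂ (fun β x) ≡ dihedral (proj₂ (fun β (y , basePos))) (proj₂ x)
  positionAction conn β y x = begin
    proj₂ (fun β x)                               ≡⟨ proj₂ (fun-cong β W-walk) ⟨
    proj₂ (fun β (walk Bundle W x₀))              ≡⟨ proj₂ (fun-walk Bundle β W x₀) ⟩
    proj₂ (walk Bundle W (fun β x₀))              ≡⟨ proj₂-walk W (fun β x₀) ⟩
    walk (PosGraph k) W u                         ≡⟨ cong (walk (PosGraph k) W) (dihedral-basePos u) ⟨
    walk (PosGraph k) W (dihedral u basePos)      ≡⟨ dihedral-walk u W basePos ⟨
    dihedral u (walk (PosGraph k) W basePos)      ≡⟨ cong (dihedral u) (proj₂-walk W x₀) ⟨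
    dihedral u (proj₂ (walk Bundle W x₀))         ≡⟨ cong (dihedral u) (proj₂ W-walk) ⟩
    dihedral u (proj₂ x)                          ∎
    where
    open ≡-Reasoning
    x₀ = y , basePos
    u = proj₂ (fun β x₀)
    W = proj₁ (conn x₀ x)
    W-walk = proj₂ (proj₂ (conn x₀ x))

  proj₁-fun-basePos : (β : Aut Bundle) → ∀ y p → proj₁ (fun β (y , p)) P.≈ proj₁ (fun β (y , basePos))
  proj₁-fun-basePos β y (i , e) = nextF-induction Q base step i e
    where
    Q : Fin (suc k) → Set
    Q i = ∀ e → proj₁ (fun β (y , i , e)) P.≈ proj₁ (fun β (y , basePos))
    move₀ : ∀ p → proj₁ (fun β (y , posR zero p)) P.≈ proj₁ (fun β (y , p))
    move₀ p = proj₁ (fun-r β zero (y , p))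
    move₁ : ∀ p → proj₁ (fun β (y , posR (suc zero) p)) P.≈ proj₁ (fun β (y , p))
    move₁ p = proj₁ (fun-r β (suc zero) (y , p))
    base : Q zero
    base false = P.refl
    base true  = move₀ basePos
    step : ∀ i → Q i → Q (nextF i)
    step i Qi false = P.trans (move₁ (i , true)) (Qi true)
    step i Qi true  = P.trans (move₀ (nextF i , false)) (step i Qi false)

  flagPart : Aut Bundle → P.Flag → P.Flag
  flagPart β y = proj₁ (fun β (y , basePos))

  recolouring : (β : Aut Bundle) (u : Pos k) → (∀ x → proj₂ (fun β x) ≡ dihedral u (proj₂ x)) →
                Iso P (Recolour P (faceMap u))
  recolouring β u β-position = record
    { to = flagPart β ; from = flagPart β⁻¹
    ; to-cong = λ y≈y′ → proj₁ (fun-cong β (y≈y′ , refl))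
    ; from-cong = λ y≈y′ → proj₁ (inv-cong β (y≈y′ , refl))
    ; from-to = λ y →
        P.trans (P.sym (proj₁-fun-basePos β⁻¹ (flagPart β y) _)) (proj₁ (inv-fun β (y , basePos)))
    ; to-from = λ y →
        P.trans (P.sym (proj₁-fun-basePos β (flagPart β⁻¹ y) _)) (proj₁ (fun-inv β (y , basePos)))
    ; to-r = to-r }
    where
    β⁻¹ = _⁻¹ Bundle β
    to-r : ∀ i y → flagPart β (P.r i y) P.≈ P.r (faceMap u i) (flagPart β y)
    to-r i y = begin
      flagPart β (P.r i y)                             ≈⟨ proj₁-fun-basePos β (P.r i y) (i , true) ⟨
      proj₁ (fun β (bundleR (suc (suc zero)) x))       ≈⟨ proj₁ (fun-r β (suc (suc zero)) x) ⟩
      P.r (proj₁ (proj₂ (fun β x))) (proj₁ (fun β x))  ≡⟨ cong (λ j → P.r (proj₁ j) (proj₁ (fun β x))) (β-position x) ⟩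
      P.r (faceMap u i) (proj₁ (fun β x))              ≈⟨ P.r-cong (faceMap u i) (proj₁-fun-basePos β y (i , false)) ⟩
      P.r (faceMap u i) (flagPart β y)                 ∎
      where
      open SetoidReasoning (setoid P)
      x = y , i , false

  dualAut : SelfDual P → Aut Bundle
  dualAut δ = record
    { fun = dual to ; inv = dual from
    ; fun-cong = λ { (y≈y′ , refl) → to-cong y≈y′ , refl }
    ; inv-cong = λ { (y≈y′ , refl) → from-cong y≈y′ , refl }
    ; inv-fun = λ { (y , i , e) → from-to y , cong₂ _,_ (opposite-involutive i) (not-involutive e) }
    ; fun-inv = λ { (y , i , e) → to-from y , cong₂ _,_ (opposite-involutive i) (not-involutive e) }
    ; fun-r = dual-r }
    where
    open Iso δ
    dual : (P.Flag → P.Flag) → Flag Bundle → Flag Bundle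
    dual f (y , i , e) = f y , opposite i , not e
    dual-r : ∀ c x → _≈_ Bundle (dual to (bundleR c x)) (bundleR c (dual to x))
    dual-r zero          (y , i , e)     = P.refl , refl
    dual-r (suc zero)    (y , i , true)  = P.refl , cong (_, true) (opposite-nextF i)
    dual-r (suc zero)    (y , i , false) = P.refl , cong (_, false) (opposite-prevF i)
    dual-r (suc (suc _)) (y , i , e)     = to-r i y , refl

module _ {k : ℕ} {P : ColGraph (suc k)} (polytope : IsPolytope P) (chiral : IsChiral P) (2≤k : 2 ≤ k) where
  private
    module P = ColGraph P

    first-last-commute : Commute P zero (fromℕ k)
    first-last-commute =
      far-commute {G = P} (proj₁ (proj₁ polytope)) (subst (1 <_) (≡.sym (toℕ-fromℕ k)) 2≤k)

  recolouring-classification : ∀ u → Iso P (Recolour P (faceMap u)) → u ≡ basePos ⊎ SelfDual P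
  recolouring-classification (c , false) ε
    with rotation-classification (faceMap (c , false)) (rotate-nextF (toℕ c))
  ... | inj₁ J₀≡0        = inj₁ (cong (_, false) (≡.trans (≡.sym (rotate-zero c)) J₀≡0))
  ... | inj₂ consecutive = ⊥-elim
    (consecutive-noncommuting polytope chiral _ _ consecutive (Iso⇒Commute ε (Commute-sym P first-last-commute)))
  recolouring-classification (c , true) ε
    with reflection-classification (faceMap (c , true)) (reflect-nextF (toℕ (opposite c)))
  ... | inj₁ J≗opposite  = inj₂ (Iso-Recolour-cong {H = P} J≗opposite ε)
  ... | inj₂ consecutive =
    ⊥-elim (consecutive-noncommuting polytope chiral _ _ consecutive (Iso⇒Commute ε first-last-commute))

  bundleAut-fixes-position : ¬ SelfDual P → Connected (Bundle P) → (β : Aut (Bundle P)) → ∀ x →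
                             proj₂ (fun β x) ≡ proj₂ x × SameOrbit P (proj₁ x) (proj₁ (fun β x))
  bundleAut-fixes-position ¬selfDual conn β (y , p) =
    [ fixes , ⊥-elim ∘ ¬selfDual ]′ (recolouring-classification u (recolouring P β u β-position))
    where
    u = proj₂ (fun β (y , basePos))
    β-position : ∀ x → proj₂ (fun β x) ≡ dihedral u (proj₂ x)
    β-position = positionAction P conn β y
    fixes : u ≡ basePos → proj₂ (fun β (y , p)) ≡ p × SameOrbit P y (proj₁ (fun β (y , p)))
    fixes u≡basePos =
      β-fixed (y , p) , Iso⇒Aut (recolouring P β basePos β-fixed) , P.sym (proj₁-fun-basePos P β y p)
      where
      β-fixed : ∀ x → proj₂ (fun β x) ≡ dihedral basePos (proj₂ x)
      β-fixed = subst (λ v → ∀ x → proj₂ (fun β x) ≡ dihedral v (proj₂ x)) u≡basePos β-position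

XV↔Fin : ∀ k → XV k ↔ Fin (2 * (suc k * 2))
XV↔Fin k = ↔-sym (↔-trans *↔× (2↔Bool ×-↔ ↔-trans *↔× (↔-refl ×-↔ 2↔Bool)))

module _ {k : ℕ} (P : ColGraph (suc k)) (polytope : IsPolytope P) (chiral : IsChiral P)
         (Φ : Flag P) (τ : Fin (suc k) → Aut P)
         (τ-Φ : ∀ i → 1 ≤ toℕ i → _≈_ P (_⊙_ P Φ (τ i)) (r P i (r P zero Φ)))
         (τ₀ : _≈A_ P (τ zero) (idAut P)) where
  private
    module P = ColGraph P
    module 𝒟 = ColGraph (Derived P τ)
    module B = ColGraph (Bundle P)
    r-involutive = proj₁ (proj₁ (proj₁ polytope))
    connected = proj₂ (proj₂ (proj₁ (proj₁ polytope)))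

  baseFlag : Bool → P.Flag
  baseFlag false = Φ
  baseFlag true  = P.r zero Φ

  baseFlag-injective : ∀ {s s′} → SameOrbit P (baseFlag s) (baseFlag s′) → s ≡ s′
  baseFlag-injective {false} {false} _    = refl
  baseFlag-injective {true}  {true}  _    = refl
  baseFlag-injective {false} {true}  Φ~r₀Φ = ⊥-elim (proj₂ chiral zero Φ Φ~r₀Φ)
  baseFlag-injective {true}  {false} r₀Φ~Φ = ⊥-elim (proj₂ chiral zero Φ (sameOrbit-sym P r₀Φ~Φ))

  coordinates-unique : ∀ s s′ γ γ′ → fun γ (baseFlag s) P.≈ fun γ′ (baseFlag s′) → s ≡ s′ × _≈A_ P γ γ′
  coordinates-unique s s′ γ γ′ γs≈γ′s′
    with baseFlag-injective {s} {s′} (sameOrbit-trans P (γ , γs≈γ′s′) (sameOrbit-sym P (γ′ , P.refl)))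
  ... | refl = refl , aut-unique P connected γ γ′ (baseFlag s) γs≈γ′s′

  orbitCoordinate : ∀ y → Σ Bool λ s → SameOrbit P (baseFlag s) y
  orbitCoordinate y = [ (false ,_) , (true ,_) ]′ (two-orbits chiral (proj₂ chiral zero Φ) y)

  Φτ : ∀ i → fun (τ i) Φ P.≈ P.r i (P.r zero Φ)
  Φτ zero    = P.trans (τ₀ Φ) (P.sym (r-involutive zero Φ))
  Φτ (suc j) = τ-Φ (suc j) (s≤s z≤n)

  r₀Φτ⁻¹ : ∀ i → inv (τ i) (P.r zero Φ) P.≈ P.r i Φ
  r₀Φτ⁻¹ i = P.trans (inv-cong (τ i) (P.sym riΦτ)) (inv-fun (τ i) (P.r i Φ))
    where
    riΦτ : fun (τ i) (P.r i Φ) P.≈ P.r zero Φ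
    riΦτ = P.trans (fun-r (τ i) i Φ) (P.trans (P.r-cong i (Φτ i)) (r-involutive i (P.r zero Φ)))

  toBundle : 𝒟.Flag → B.Flag
  toBundle ((s , p) , γ) = fun γ (baseFlag s) , p

  fromBundle : B.Flag → 𝒟.Flag
  fromBundle (y , p) = (proj₁ (orbitCoordinate y) , p) , proj₁ (proj₂ (orbitCoordinate y))

  fromBundle-unique : ∀ y p s γ → fun γ (baseFlag s) P.≈ y → fromBundle (y , p) 𝒟.≈ ((s , p) , γ)
  fromBundle-unique y p s γ γs≈y with orbitCoordinate y
  ... | s′ , γ′ , γ′s′≈y with coordinates-unique s′ s γ′ γ (P.trans γ′s′≈y (P.sym γs≈y))
  ... | refl , γ′≈γ = refl , γ′≈γ

  derived≅bundle : Iso (Derived P τ) (Bundle P)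
  derived≅bundle = record
    { to = toBundle ; from = fromBundle
    ; to-cong = λ { {(s , _) , _} (refl , γ≈γ′) → γ≈γ′ (baseFlag s) , refl }
    ; from-cong = λ { {y , p} {y′ , _} (y≈y′ , refl) →
        let (s′ , γ′ , γ′s′≈y′) = orbitCoordinate y′
        in  fromBundle-unique y p s′ γ′ (P.trans γ′s′≈y′ (P.sym y≈y′)) }
    ; from-to = λ { ((s , p) , γ) → fromBundle-unique _ p s γ P.refl }
    ; to-from = λ { (y , p) → proj₂ (proj₂ (orbitCoordinate y)) , refl }
    ; to-r = to-r }
    where
    to-r : ∀ c x → toBundle (𝒟.r c x) B.≈ bundleR P c (toBundle x)
    to-r zero          ((s , i , e) , γ)     = P.refl , refl
    to-r (suc zero)    ((s , i , true) , γ)  = P.refl , refl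
    to-r (suc zero)    ((s , i , false) , γ) = P.refl , refl
    to-r (suc (suc _)) ((true , i , e) , γ)  = P.trans (fun-cong γ (Φτ i)) (fun-r γ i (P.r zero Φ)) , refl
    to-r (suc (suc _)) ((false , i , e) , γ) = P.trans (fun-cong γ (r₀Φτ⁻¹ i)) (fun-r γ i Φ) , refl

  rightMul : Aut P → Aut (Derived P τ)
  rightMul ρ = record
    { fun = λ { (v , γ) → v , _·_ P γ ρ }
    ; inv = λ { (v , γ) → v , _·_ P γ (_⁻¹ P ρ) }
    ; fun-cong = λ { (refl , γ≈γ′) → refl , λ z → fun-cong ρ (γ≈γ′ z) }
    ; inv-cong = λ { (refl , γ≈γ′) → refl , λ z → inv-cong ρ (γ≈γ′ z) }
    ; inv-fun = λ { (v , γ) → refl , λ z → inv-fun ρ (fun γ z) }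
    ; fun-inv = λ { (v , γ) → refl , λ z → fun-inv ρ (fun γ z) }
    ; fun-r = λ { c (v , γ) → refl , λ z → P.refl } }

  fibre-sameOrbit : ∀ v γ δ → SameOrbit (Derived P τ) (v , γ) (v , δ)
  fibre-sameOrbit v γ δ = rightMul (_·_ P (_⁻¹ P γ) δ) , refl , λ z → fun-cong δ (inv-fun γ z)

  ¬SelfDual⇒sameVertex : 2 ≤ k → Connected (Derived P τ) → ¬ SelfDual P →
                         ∀ x y → SameOrbit (Derived P τ) x y → proj₁ x ≡ proj₁ y
  ¬SelfDual⇒sameVertex 2≤k conn ¬selfDual x@((s , p) , γ) y@((s′ , p′) , δ) (α , αx≈y) =
    cong₂ _,_ (baseFlag-injective baseFlags~) (≡.trans (≡.sym (proj₁ β-fixes)) (proj₂ βx≈y))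
    where
    β = conjAut derived≅bundle α
    βx≈y : fun β (toBundle x) B.≈ toBundle y
    βx≈y = B.trans (to-conjAut derived≅bundle α x) (Iso.to-cong derived≅bundle {fun α x} {y} αx≈y)
    β-fixes =
      bundleAut-fixes-position polytope chiral 2≤k ¬selfDual (Iso⇒Connected derived≅bundle conn) β (toBundle x)
    γs~δs′ : SameOrbit P (fun γ (baseFlag s)) (fun δ (baseFlag s′))
    γs~δs′ = let (ε , e) = proj₂ β-fixes in ε , P.trans e (proj₁ βx≈y)
    baseFlags~ : SameOrbit P (baseFlag s) (baseFlag s′)
    baseFlags~ = sameOrbit-trans P (γ , P.refl) (sameOrbit-trans P γs~δs′ (sameOrbit-sym P (δ , P.refl)))

  ¬SelfDual⇒STG : 2 ≤ k → Connected (Derived P τ) → ¬ SelfDual P → STGIsoTo (Derived P τ) (XGraph k)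
  ¬SelfDual⇒STG 2≤k conn ¬selfDual = record
    { π = proj₁ ; π-cong = proj₁
    ; π-surj = λ v → (v , idAut P) , refl
    ; π-orbit⇒ = ¬SelfDual⇒sameVertex 2≤k conn ¬selfDual
    ; π-orbit⇐ = λ { (v , γ) (.v , δ) refl → fibre-sameOrbit v γ δ }
    ; π-r = λ i x → refl }

  STG⇒sameVertex : STGIsoTo (Derived P τ) (XGraph k) →
                   ∀ x y → SameOrbit (Derived P τ) x y → proj₁ x ≡ proj₁ y
  STG⇒sameVertex stg x y x~y =
    fibreClass-injective (≡.trans (π-fibre x) (≡.trans (π-orbit⇒ x y x~y) (≡.sym (π-fibre y))))
    where
    open STGIsoTo stg
    fibreClass : XV k → XV k
    fibreClass v = π (v , idAut P)
    π-fibre : ∀ x → fibreClass (proj₁ x) ≡ π x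
    π-fibre (v , γ) = π-orbit⇒ _ _ (fibre-sameOrbit v (idAut P) γ)
    fibreClass-injective : Injective _≡_ _≡_ fibreClass
    fibreClass-injective = finite-surjective⇒injective (XV↔Fin k) fibreClass
      (λ w → proj₁ (proj₁ (π-surj w)) , ≡.trans (π-fibre _) (proj₂ (π-surj w)))

  derivedDualAut : SelfDual P → Aut (Derived P τ)
  derivedDualAut δ = conjAut (Iso-sym derived≅bundle) (dualAut P δ)

  derivedDualAut-moves : (δ : SelfDual P) → ∀ x → proj₁ (fun (derivedDualAut δ) x) ≢ proj₁ x
  derivedDualAut-moves δ x eq = not-¬ refl (≡.sym (cong (proj₂ ∘ proj₂) eq))

  STG⇒¬SelfDual : STGIsoTo (Derived P τ) (XGraph k) → ¬ SelfDual P
  STG⇒¬SelfDual stg δ =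
    derivedDualAut-moves δ x (≡.sym (STG⇒sameVertex stg x (fun α x) (α , 𝒟.refl {fun α x})))
    where
    α = derivedDualAut δ
    x : 𝒟.Flag
    x = (true , basePos) , idAut P

lemma9p1 : (m : ℕ) (P : ColGraph (suc (suc (suc m)))) →
    IsPolytope P → IsChiral P →
    (Φ : Flag P) (τ : Fin (suc (suc (suc m))) → Aut P) →
    (∀ i → 1 ≤ toℕ i → _≈_ P (_⊙_ P Φ (τ i)) (r P i (r P zero Φ))) →
    _≈A_ P (τ zero) (idAut P) →
    IsManiplex (Derived P τ) →
    (STGIsoTo (Derived P τ) (XGraph (suc (suc m))) ⇔ (¬ SelfDual P))
lemma9p1 m P polytope chiral Φ τ τ-Φ τ₀ maniplex = mk⇔
  (STG⇒¬SelfDual P polytope chiral Φ τ τ-Φ τ₀)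
  (¬SelfDual⇒STG P polytope chiral Φ τ τ-Φ τ₀ (s≤s (s≤s z≤n)) (proj₂ (proj₂ (proj₁ maniplex))))
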